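{- For every integer $k \geq 3$ there exists a graph $G$ such that, if $P$ is a minimum-size solution of \textsc{PAU-VC} on $G$ and $M$ is a minimum-size solution of \textsc{MU-VC} on $G$, then $|P| \geq k$ and $|M| = 2$.
   Context: All graphs are finite, simple, undirected, without loops. A vertex cover of a graph $G$ is a set of vertices intersecting every edge; a minimum vertex cover is one of smallest cardinality. For $S \subseteq V(G)$, $G - S$ is the subgraph induced by $V(G)\setminus S$. A solution of \textsc{Pre-Assignment for Unification of Minimum Vertex Cover} (\textsc{PAU-VC}) on $G$ is a set $S \subseteq V(G)$ such that there is exactly one minimum vertex cover of $G$ that contains $S$. A solution of \textsc{Modulator to Unique Minimum Vertex Cover} (\textsc{MU-VC}) on $G$ is a set $S \subseteq V(G)$ such that $G - S$ has a unique minimum vertex cover. A minimum-size solution is a solution of smallest cardinality. -}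

module Defs where

open import Data.Nat using (ℕ; _≤_)
open import Data.Bool using (Bool; true; false)
open import Data.Fin using (Fin)
open import Data.Fin.Subset using (Subset; _∈_; _∉_; _⊆_; ∣_∣)
open import Data.Product using (Σ; _×_; ∃)
open import Data.Sum using (_⊎_)
open import Relation.Binary.PropositionalEquality using (_≡_)
open import Relation.Nullary using (¬_)

record Graph : Set where
  field
    n     : ℕ
    adj   : Fin n → Fin n → Bool
    sym   : ∀ u v → adj u v ≡ adj v u
    irrefl : ∀ v → adj v v ≡ false
open Graph public

IsVC : (G : Graph) → Subset (n G) → Set
IsVC G C = ∀ u v → adj G u v ≡ true → u ∈ C ⊎ v ∈ C

IsMinVC : (G : Graph) → Subset (n G) → Set
IsMinVC G C = IsVC G C × (∀ D → IsVC G D → ∣ C ∣ ≤ ∣ D ∣)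

IsPAU : (G : Graph) → Subset (n G) → Set
IsPAU G S = Σ (Subset (n G)) λ C →
  (IsMinVC G C × S ⊆ C) × (∀ D → IsMinVC G D → S ⊆ D → D ≡ C)

-- Vertex covers of the induced subgraph G - S, represented as subsets of
-- V(G) avoiding S that cover every edge with both endpoints outside S.
IsVCminus : (G : Graph) → Subset (n G) → Subset (n G) → Set
IsVCminus G S C =
  (∀ v → v ∈ C → v ∉ S) ×
  (∀ u v → u ∉ S → v ∉ S → adj G u v ≡ true → u ∈ C ⊎ v ∈ C)

IsMinVCminus : (G : Graph) → Subset (n G) → Subset (n G) → Set
IsMinVCminus G S C = IsVCminus G S C × (∀ D → IsVCminus G S D → ∣ C ∣ ≤ ∣ D ∣)

IsMU : (G : Graph) → Subset (n G) → Set
IsMU G S = Σ (Subset (n G)) λ C →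
  IsMinVCminus G S C × (∀ D → IsMinVCminus G S D → D ≡ C)

IsMinPAU : (G : Graph) → Subset (n G) → Set
IsMinPAU G S = IsPAU G S × (∀ T → IsPAU G T → ∣ S ∣ ≤ ∣ T ∣)

IsMinMU : (G : Graph) → Subset (n G) → Set
IsMinMU G S = IsMU G S × (∀ T → IsMU G T → ∣ S ∣ ≤ ∣ T ∣)

-- Call C pinned by (T, S) if it is the only minimum vertex cover of G − T containing S.
-- A pinned C admits no exchange: if p ∈ C ∖ S has every neighbour outside T in C except
-- possibly a vertex q ∉ C, then C − p + q would be a second such cover.  The witness graph
-- is a spider with a centre, two leaves and k legs centre – inner i – outer i.  Exchanging
-- along a leg (and, when the centre is uncovered, a leaf for the centre) shows that, unless
-- both leaves are deleted, every leg meets T or S.  So a PAU solution meets all k legs, and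
-- an MU solution contains both leaves or meets all k ≥ 2 legs; deleting the two leaves does
-- suffice, the inner vertices being the unique minimum cover of the rest because a cover
-- using the centre needs k + 1 vertices.

module Submission where

open import Defs
open import Data.Nat using (ℕ; zero; suc; _+_; _*_; _≤_; _<_; z≤n; s≤s)
open import Data.Nat.Properties using (≤-trans; ≤-antisym; <⇒≱; n≤1+n; +-suc; +-comm; +-monoʳ-≤; module ≤-Reasoning)
open import Data.Fin using (Fin; zero; suc)
open import Data.Fin.Properties using (_≟_)
open import Data.Fin.Subset using (Subset; inside; outside; _∈_; _∉_; _⊆_; ∣_∣; ⊥; ⁅_⁆; _∪_; _-_; _─_)
open import Data.Fin.Subset.Properties
  using (_∈?_; ∉⊥; ⊥⊆; ∣⊥∣≡0; ∣⁅x⁆∣≡1; x∈⁅x⁆; x∈⁅y⁆⇒x≡y; x∈p∪q⁺; x∈p∪q⁻; p─q⊆p;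
         x∈p∧x≢y⇒x∈p-y; x∈p⇒∣p-x∣<∣p∣; ⊆-antisym; ∣p∣≤∣x∷p∣; drop-there)
open import Data.Vec using ([]; _∷_; here; there)
open import Data.Bool using (Bool; true; false)
open import Data.Product using (Σ; ∃; _×_; _,_; proj₁)
open import Data.Sum using (_⊎_; inj₁; inj₂)
import Data.Sum as Sum
open import Data.Empty using (⊥-elim)
open import Relation.Binary.PropositionalEquality using (_≡_; _≢_; refl; trans; cong; subst)
  renaming (sym to ≡-sym)
open import Relation.Nullary using (¬_; yes; no)
open import Function using (_∘_)

∣p∪q∣≤∣p∣+∣q∣ : ∀ {n} (p q : Subset n) → ∣ p ∪ q ∣ ≤ ∣ p ∣ + ∣ q ∣
∣p∪q∣≤∣p∣+∣q∣ [] [] = z≤n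
∣p∪q∣≤∣p∣+∣q∣ (inside ∷ p) (s ∷ q) = s≤s (≤-trans (∣p∪q∣≤∣p∣+∣q∣ p q) (+-monoʳ-≤ ∣ p ∣ (∣p∣≤∣x∷p∣ s q)))
∣p∪q∣≤∣p∣+∣q∣ (outside ∷ p) (outside ∷ q) = ∣p∪q∣≤∣p∣+∣q∣ p q
∣p∪q∣≤∣p∣+∣q∣ (outside ∷ p) (inside ∷ q) =
  subst (suc ∣ p ∪ q ∣ ≤_) (≡-sym (+-suc ∣ p ∣ ∣ q ∣)) (s≤s (∣p∪q∣≤∣p∣+∣q∣ p q))

x∈p─q⇒x∉q : ∀ {n} {x : Fin n} (p q : Subset n) → x ∈ p ─ q → x ∉ q
x∈p─q⇒x∉q (s ∷ p) (outside ∷ q) here ()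
x∈p─q⇒x∉q (s ∷ p) (outside ∷ q) (there x∈) (there x∈q) = x∈p─q⇒x∉q p q x∈ x∈q
x∈p─q⇒x∉q (s ∷ p) (inside ∷ q) (there x∈) (there x∈q) = x∈p─q⇒x∉q p q x∈ x∈q

x≢y∈p⇒2≤∣p∣ : ∀ {n} {x y : Fin n} {p : Subset n} → x ∈ p → y ∈ p → x ≢ y → 2 ≤ ∣ p ∣
x≢y∈p⇒2≤∣p∣ {x = x} {p = p} x∈p y∈p x≢y = ≤-trans (s≤s 1≤∣p-x∣) (x∈p⇒∣p-x∣<∣p∣ x∈p)
  where
  1≤∣p-x∣ : 1 ≤ ∣ p - x ∣
  1≤∣p-x∣ = ≤-trans (s≤s z≤n) (x∈p⇒∣p-x∣<∣p∣ (x∈p∧x≢y⇒x∈p-y y∈p (x≢y ∘ ≡-sym)))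

module VertexCovers (G : Graph) where

  private
    V : Set
    V = Fin (n G)

  NeighboursIn : Subset (n G) → V → (V → Set) → Set
  NeighboursIn T p P = ∀ w → w ∉ T → adj G p w ≡ true → P w

  -- PAU-VC is the case T = ⊥ and MU-VC the case S = ⊥.
  PinnedMinVCminus : (T S C : Subset (n G)) → Set
  PinnedMinVCminus T S C =
    IsMinVCminus G T C × S ⊆ C × (∀ D → IsMinVCminus G T D → S ⊆ D → D ≡ C)

  adj⇒≢ : ∀ {x y} → adj G x y ≡ true → x ≢ y
  adj⇒≢ {x} e refl with trans (≡-sym e) (irrefl G x)
  ... | ()

  cover-forces : ∀ {T C x y} → IsVCminus G T C → x ∉ T → y ∉ T → adj G x y ≡ true →
                 x ∉ C → y ∈ C
  cover-forces (_ , covers) x∉T y∉T e x∉C with covers _ _ x∉T y∉T e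
  ... | inj₁ x∈C = ⊥-elim (x∉C x∈C)
  ... | inj₂ y∈C = y∈C

  cover-transfer : ∀ {T C C′} → IsVCminus G T C → (∀ x → x ∈ C′ → x ∉ T) →
                   (∀ x → x ∈ C → x ∉ C′ → NeighboursIn T x (_∈ C′)) → IsVCminus G T C′
  cover-transfer {T} {C} {C′} (_ , covers) avoids moved = avoids , covers′
    where
    covers′ : ∀ u v → u ∉ T → v ∉ T → adj G u v ≡ true → u ∈ C′ ⊎ v ∈ C′
    covers′ u v u∉T v∉T e with covers u v u∉T v∉T e | u ∈? C′ | v ∈? C′
    ... | _        | yes u∈C′ | _        = inj₁ u∈C′
    ... | _        | _        | yes v∈C′ = inj₂ v∈C′
    ... | inj₁ u∈C | no u∉C′  | no _     = inj₂ (moved u u∈C u∉C′ v v∉T e)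
    ... | inj₂ v∈C | no _     | no v∉C′  =
      inj₁ (moved v v∈C v∉C′ u u∉T (trans (sym G v u) e))

  minVCminus-irredundant : ∀ {T C p} → IsMinVCminus G T C → p ∈ C → ¬ NeighboursIn T p (_∈ C)
  minVCminus-irredundant {T} {C} {p} (cover , minimal) p∈C nbrs⊆C =
    <⇒≱ (x∈p⇒∣p-x∣<∣p∣ p∈C) (minimal (C - p) cover′)
    where
    cover′ : IsVCminus G T (C - p)
    cover′ = cover-transfer cover (λ x x∈ → proj₁ cover x (p─q⊆p C ⁅ p ⁆ x∈)) moved
      where
      moved : ∀ x → x ∈ C → x ∉ C - p → NeighboursIn T x (_∈ C - p)
      moved x x∈C x∉C-p w w∉T e with x ≟ p
      ... | no x≢p = ⊥-elim (x∉C-p (x∈p∧x≢y⇒x∈p-y x∈C x≢p))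
      ... | yes refl = x∈p∧x≢y⇒x∈p-y (nbrs⊆C w w∉T e) (adj⇒≢ e ∘ ≡-sym)

  exchange : Subset (n G) → V → V → Subset (n G)
  exchange C p q = (C - p) ∪ ⁅ q ⁆

  q∈exchange : ∀ C p q → q ∈ exchange C p q
  q∈exchange C p q = x∈p∪q⁺ (inj₂ (x∈⁅x⁆ q))

  ∈-exchange⁺ : ∀ {C p q x} → x ∈ C → x ≢ p → x ∈ exchange C p q
  ∈-exchange⁺ x∈C x≢p = x∈p∪q⁺ (inj₁ (x∈p∧x≢y⇒x∈p-y x∈C x≢p))

  ∈-exchange⁻ : ∀ {C p q x} → x ∈ exchange C p q → x ≡ q ⊎ (x ∈ C × x ≢ p)
  ∈-exchange⁻ {C} {p} {q} x∈ with x∈p∪q⁻ (C - p) ⁅ q ⁆ x∈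
  ... | inj₁ x∈C-p = inj₂ (p─q⊆p C ⁅ p ⁆ x∈C-p ,
                          λ { refl → x∈p─q⇒x∉q C ⁅ p ⁆ x∈C-p (x∈⁅x⁆ p) })
  ... | inj₂ x∈⁅q⁆ = inj₁ (x∈⁅y⁆⇒x≡y q x∈⁅q⁆)

  ∣exchange∣≤∣C∣ : ∀ {C p} q → p ∈ C → ∣ exchange C p q ∣ ≤ ∣ C ∣
  ∣exchange∣≤∣C∣ {C} {p} q p∈C = begin
    ∣ (C - p) ∪ ⁅ q ⁆ ∣      ≤⟨ ∣p∪q∣≤∣p∣+∣q∣ (C - p) ⁅ q ⁆ ⟩
    ∣ C - p ∣ + ∣ ⁅ q ⁆ ∣    ≡⟨ cong (∣ C - p ∣ +_) (∣⁅x⁆∣≡1 q) ⟩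
    ∣ C - p ∣ + 1            ≡⟨ +-comm ∣ C - p ∣ 1 ⟩
    suc ∣ C - p ∣            ≤⟨ x∈p⇒∣p-x∣<∣p∣ p∈C ⟩
    ∣ C ∣                    ∎
    where open ≤-Reasoning

  exchange-minVCminus : ∀ {T C p q} → IsMinVCminus G T C → p ∈ C → q ∉ T →
                        NeighboursIn T p (λ w → w ≡ q ⊎ w ∈ C) →
                        IsMinVCminus G T (exchange C p q)
  exchange-minVCminus {T} {C} {p} {q} (cover , minimal) p∈C q∉T nbrs =
    cover-transfer cover avoids moved ,
    λ D D-cover → ≤-trans (∣exchange∣≤∣C∣ q p∈C) (minimal D D-cover)
    where
    avoids : ∀ x → x ∈ exchange C p q → x ∉ T
    avoids x x∈ with ∈-exchange⁻ x∈
    ... | inj₁ refl = q∉T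
    ... | inj₂ (x∈C , _) = proj₁ cover x x∈C
    moved : ∀ x → x ∈ C → x ∉ exchange C p q → NeighboursIn T x (_∈ exchange C p q)
    moved x x∈C x∉ w w∉T e with x ≟ p
    ... | no x≢p = ⊥-elim (x∉ (∈-exchange⁺ x∈C x≢p))
    ... | yes refl with nbrs w w∉T e
    ...   | inj₁ refl = q∈exchange C p q
    ...   | inj₂ w∈C  = ∈-exchange⁺ w∈C (adj⇒≢ e ∘ ≡-sym)

  pinned-noExchange : ∀ {T S C p q} → PinnedMinVCminus T S C → p ∈ C → p ∉ S → q ∉ C → q ∉ T →
                      ¬ NeighboursIn T p (λ w → w ≡ q ⊎ w ∈ C)
  pinned-noExchange {T} {S} {C} {p} {q} (minC , S⊆C , unique) p∈C p∉S q∉C q∉T nbrs =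
    q∉C (subst (q ∈_) C′≡C (q∈exchange C p q))
    where
    S⊆C′ : S ⊆ exchange C p q
    S⊆C′ x∈S = ∈-exchange⁺ (S⊆C x∈S) (λ { refl → p∉S x∈S })
    C′≡C : exchange C p q ≡ C
    C′≡C = unique _ (exchange-minVCminus minC p∈C q∉T nbrs) S⊆C′

  IsVC⇒IsVCminus⊥ : ∀ {C} → IsVC G C → IsVCminus G ⊥ C
  IsVC⇒IsVCminus⊥ cover = (λ _ _ → ∉⊥) , (λ u v _ _ → cover u v)

  IsVCminus⊥⇒IsVC : ∀ {C} → IsVCminus G ⊥ C → IsVC G C
  IsVCminus⊥⇒IsVC (_ , covers) u v = covers u v ∉⊥ ∉⊥

  IsPAU⇒pinned : ∀ {S} → IsPAU G S → ∃ (PinnedMinVCminus ⊥ S)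
  IsPAU⇒pinned (C , ((cover , minimal) , S⊆C) , unique) =
    C , (IsVC⇒IsVCminus⊥ cover , (λ D → minimal D ∘ IsVCminus⊥⇒IsVC)) , S⊆C ,
    λ D (D-cover , D-minimal) → unique D (IsVCminus⊥⇒IsVC D-cover , λ E → D-minimal E ∘ IsVC⇒IsVCminus⊥)

  IsMU⇒pinned : ∀ {T} → IsMU G T → ∃ (PinnedMinVCminus T ⊥)
  IsMU⇒pinned (C , minC , unique) = C , minC , ⊥⊆ , λ D minD _ → unique D minD

left right : ∀ {K} → Fin K → Fin (K * 2)
left zero = zero
left (suc i) = suc (suc (left i))
right zero = suc zero
right (suc i) = suc (suc (right i))

data Half {K} : Fin (K * 2) → Set where
  leftʰ  : (i : Fin K) → Half (left i)
  rightʰ : (i : Fin K) → Half (right i)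

half : ∀ {K} (x : Fin (K * 2)) → Half {K} x
half {suc K} zero = leftʰ zero
half {suc K} (suc zero) = rightʰ zero
half {suc K} (suc (suc x)) with half {K} x
... | leftʰ i = leftʰ (suc i)
... | rightʰ i = rightʰ (suc i)

isLeft : ∀ {K} → Fin (K * 2) → Bool
isLeft {suc K} zero = true
isLeft {suc K} (suc zero) = false
isLeft {suc K} (suc (suc x)) = isLeft {K} x

isLeft-left : ∀ {K} (i : Fin K) → isLeft {K} (left i) ≡ true
isLeft-left zero = refl
isLeft-left (suc i) = isLeft-left i

isLeft-right : ∀ {K} (i : Fin K) → isLeft {K} (right i) ≡ false
isLeft-right zero = refl
isLeft-right (suc i) = isLeft-right i

matched : ∀ {K} → Fin (K * 2) → Fin (K * 2) → Bool
matched {suc K} zero (suc zero) = true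
matched {suc K} (suc zero) zero = true
matched {suc K} (suc (suc x)) (suc (suc y)) = matched {K} x y
matched {suc K} _ _ = false

matched-sym : ∀ {K} (x y : Fin (K * 2)) → matched {K} x y ≡ matched {K} y x
matched-sym {suc K} zero zero = refl
matched-sym {suc K} zero (suc zero) = refl
matched-sym {suc K} zero (suc (suc y)) = refl
matched-sym {suc K} (suc zero) zero = refl
matched-sym {suc K} (suc zero) (suc zero) = refl
matched-sym {suc K} (suc zero) (suc (suc y)) = refl
matched-sym {suc K} (suc (suc x)) zero = refl
matched-sym {suc K} (suc (suc x)) (suc zero) = refl
matched-sym {suc K} (suc (suc x)) (suc (suc y)) = matched-sym {K} x y

matched-irrefl : ∀ {K} (x : Fin (K * 2)) → matched {K} x x ≡ false
matched-irrefl {suc K} zero = refl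
matched-irrefl {suc K} (suc zero) = refl
matched-irrefl {suc K} (suc (suc x)) = matched-irrefl {K} x

matched-left-right : ∀ {K} (i : Fin K) → matched {K} (left i) (right i) ≡ true
matched-left-right zero = refl
matched-left-right (suc i) = matched-left-right i

matched-left : ∀ {K} (i : Fin K) y → matched {K} (left i) y ≡ true → y ≡ right i
matched-left zero zero ()
matched-left zero (suc zero) e = refl
matched-left zero (suc (suc y)) ()
matched-left (suc i) zero ()
matched-left (suc i) (suc zero) ()
matched-left (suc i) (suc (suc y)) e = cong (λ z → suc (suc z)) (matched-left i y e)

matched-right : ∀ {K} (i : Fin K) y → matched {K} (right i) y ≡ true → y ≡ left i
matched-right zero zero e = refl
matched-right zero (suc y) ()
matched-right (suc i) zero ()
matched-right (suc i) (suc zero) ()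
matched-right (suc i) (suc (suc y)) e = cong (λ z → suc (suc z)) (matched-right i y e)

matching-cover-size : ∀ {K} (W : Subset (K * 2)) → (∀ (i : Fin K) → left i ∈ W ⊎ right i ∈ W) → K ≤ ∣ W ∣
matching-cover-size {zero} W hits = z≤n
matching-cover-size {suc K} (s ∷ t ∷ W) hits =
  first-pair (hits zero) (matching-cover-size W λ i → Sum.map drop-there² drop-there² (hits (suc i)))
  where
  drop-there² : ∀ {x} → suc (suc x) ∈ s ∷ t ∷ W → x ∈ W
  drop-there² = drop-there ∘ drop-there
  first-pair : zero ∈ s ∷ t ∷ W ⊎ suc zero ∈ s ∷ t ∷ W → K ≤ ∣ W ∣ → suc K ≤ ∣ s ∷ t ∷ W ∣
  first-pair (inj₁ here)         K≤∣W∣ = s≤s (≤-trans K≤∣W∣ (∣p∣≤∣x∷p∣ t W))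
  first-pair (inj₂ (there here)) K≤∣W∣ = ≤-trans (s≤s K≤∣W∣) (∣p∣≤∣x∷p∣ s (inside ∷ W))

lefts : ∀ K → Subset (K * 2)
lefts zero = []
lefts (suc K) = inside ∷ outside ∷ lefts K

∣lefts∣≡K : ∀ K → ∣ lefts K ∣ ≡ K
∣lefts∣≡K zero = refl
∣lefts∣≡K (suc K) = cong suc (∣lefts∣≡K K)

left∈lefts : ∀ {K} (i : Fin K) → left i ∈ lefts K
left∈lefts zero = here
left∈lefts (suc i) = there (there (left∈lefts i))

right∉lefts : ∀ {K} (i : Fin K) → right i ∉ lefts K
right∉lefts zero (there ())
right∉lefts (suc i) (there (there r∈)) = right∉lefts i r∈

module Spider (K : ℕ) where

  Vertex : Set
  Vertex = Fin (3 + K * 2)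

  centre : Vertex
  centre = zero

  leaf : Fin 2 → Vertex
  leaf zero = suc zero
  leaf (suc zero) = suc (suc zero)

  inner outer : Fin K → Vertex
  inner i = suc (suc (suc (left i)))
  outer i = suc (suc (suc (right i)))

  -- The centre is adjacent to both leaves and to every inner i; inner i – outer i are the
  -- remaining edges.
  adjacent : Vertex → Vertex → Bool
  adjacent zero (suc zero) = true
  adjacent zero (suc (suc zero)) = true
  adjacent zero (suc (suc (suc y))) = isLeft {K} y
  adjacent (suc zero) zero = true
  adjacent (suc (suc zero)) zero = true
  adjacent (suc (suc (suc x))) zero = isLeft {K} x
  adjacent (suc (suc (suc x))) (suc (suc (suc y))) = matched {K} x y
  adjacent _ _ = false

  adjacent-sym : ∀ x y → adjacent x y ≡ adjacent y x
  adjacent-sym zero zero = refl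
  adjacent-sym zero (suc zero) = refl
  adjacent-sym zero (suc (suc zero)) = refl
  adjacent-sym zero (suc (suc (suc y))) = refl
  adjacent-sym (suc zero) zero = refl
  adjacent-sym (suc zero) (suc zero) = refl
  adjacent-sym (suc zero) (suc (suc zero)) = refl
  adjacent-sym (suc zero) (suc (suc (suc y))) = refl
  adjacent-sym (suc (suc zero)) zero = refl
  adjacent-sym (suc (suc zero)) (suc zero) = refl
  adjacent-sym (suc (suc zero)) (suc (suc zero)) = refl
  adjacent-sym (suc (suc zero)) (suc (suc (suc y))) = refl
  adjacent-sym (suc (suc (suc x))) zero = refl
  adjacent-sym (suc (suc (suc x))) (suc zero) = refl
  adjacent-sym (suc (suc (suc x))) (suc (suc zero)) = refl
  adjacent-sym (suc (suc (suc x))) (suc (suc (suc y))) = matched-sym {K} x y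

  adjacent-irrefl : ∀ x → adjacent x x ≡ false
  adjacent-irrefl zero = refl
  adjacent-irrefl (suc zero) = refl
  adjacent-irrefl (suc (suc zero)) = refl
  adjacent-irrefl (suc (suc (suc x))) = matched-irrefl {K} x

  spider : Graph
  spider = record { n = 3 + K * 2 ; adj = adjacent ; sym = adjacent-sym ; irrefl = adjacent-irrefl }

  data View : Vertex → Set where
    centreᵛ : View centre
    leafᵛ   : (j : Fin 2) → View (leaf j)
    innerᵛ  : (i : Fin K) → View (inner i)
    outerᵛ  : (i : Fin K) → View (outer i)

  view : (x : Vertex) → View x
  view zero = centreᵛ
  view (suc zero) = leafᵛ zero
  view (suc (suc zero)) = leafᵛ (suc zero)
  view (suc (suc (suc x))) with half {K} x
  ... | leftʰ i = innerᵛ i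
  ... | rightʰ i = outerᵛ i

  centre–leaf : ∀ j → adjacent centre (leaf j) ≡ true
  centre–leaf zero = refl
  centre–leaf (suc zero) = refl

  centre–inner : ∀ i → adjacent centre (inner i) ≡ true
  centre–inner = isLeft-left

  inner–outer : ∀ i → adjacent (inner i) (outer i) ≡ true
  inner–outer = matched-left-right

  leaf-neighbour : ∀ j w → adjacent (leaf j) w ≡ true → w ≡ centre
  leaf-neighbour zero zero e = refl
  leaf-neighbour (suc zero) zero e = refl
  leaf-neighbour zero (suc w) ()
  leaf-neighbour (suc zero) (suc w) ()

  inner-neighbour : ∀ i w → adjacent (inner i) w ≡ true → w ≡ centre ⊎ w ≡ outer i
  inner-neighbour i zero e = inj₁ refl
  inner-neighbour i (suc (suc (suc w))) e = inj₂ (cong (λ y → suc (suc (suc y))) (matched-left i w e))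
  inner-neighbour i (suc zero) ()
  inner-neighbour i (suc (suc zero)) ()

  outer-neighbour : ∀ i w → adjacent (outer i) w ≡ true → w ≡ inner i
  outer-neighbour i zero e with trans (≡-sym e) (isLeft-right i)
  ... | ()
  outer-neighbour i (suc (suc (suc w))) e = cong (λ y → suc (suc (suc y))) (matched-right i w e)
  outer-neighbour i (suc zero) ()
  outer-neighbour i (suc (suc zero)) ()

  centre-neighbour : ∀ w → adjacent centre w ≡ true → (∃ λ j → w ≡ leaf j) ⊎ (∃ λ i → w ≡ inner i)
  centre-neighbour w e with view w
  ... | leafᵛ j = inj₁ (j , refl)
  ... | innerᵛ i = inj₂ (i , refl)
  ... | outerᵛ i with trans (≡-sym e) (isLeft-right i)
  ...   | ()

  open VertexCovers spider

  MeetsAllLegs : Subset (n spider) → Set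
  MeetsAllLegs P = ∀ i → inner i ∈ P ⊎ outer i ∈ P

  private
    legs-size : ∀ {s t u} W → MeetsAllLegs (s ∷ t ∷ u ∷ W) → K ≤ ∣ W ∣
    legs-size {s} {t} {u} W meets = matching-cover-size W λ i → Sum.map drop-there³ drop-there³ (meets i)
      where
      drop-there³ : ∀ {x} → suc (suc (suc x)) ∈ s ∷ t ∷ u ∷ W → x ∈ W
      drop-there³ = drop-there ∘ drop-there ∘ drop-there

  meetsAllLegs⇒K≤∣P∣ : ∀ P → MeetsAllLegs P → K ≤ ∣ P ∣
  meetsAllLegs⇒K≤∣P∣ (s ∷ t ∷ u ∷ W) meets =
    ≤-trans (legs-size W meets)
            (≤-trans (∣p∣≤∣x∷p∣ u W) (≤-trans (∣p∣≤∣x∷p∣ t (u ∷ W)) (∣p∣≤∣x∷p∣ s (t ∷ u ∷ W))))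

  meetsAllLegs⇒K<∣P∣ : ∀ P → centre ∈ P → MeetsAllLegs P → K < ∣ P ∣
  meetsAllLegs⇒K<∣P∣ (inside ∷ t ∷ u ∷ W) here meets =
    s≤s (≤-trans (legs-size W meets) (≤-trans (∣p∣≤∣x∷p∣ u W) (∣p∣≤∣x∷p∣ t (u ∷ W))))

  LeavesFree : (T S : Subset (n spider)) → Set
  LeavesFree T S = (∀ j → leaf j ∉ T) ⊎ (∃ λ j → leaf j ∉ T × leaf j ∉ S)

  pinned-centre : ∀ {T S C} → PinnedMinVCminus T S C → LeavesFree T S → centre ∈ T ⊎ centre ∈ C
  pinned-centre {T} {S} {C} pinned@(minC@(cover , _) , _) free with centre ∈? T | centre ∈? C
  ... | yes c∈T | _       = inj₁ c∈T
  ... | no _    | yes c∈C = inj₂ c∈C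
  ... | no c∉T  | no c∉C  = ⊥-elim (impossible free)
    where
    leaf∈C : ∀ j → leaf j ∉ T → leaf j ∈ C
    leaf∈C j l∉T = cover-forces cover c∉T l∉T (centre–leaf j) c∉C
    impossible : ¬ LeavesFree T S
    impossible (inj₂ (j , l∉T , l∉S)) =
      pinned-noExchange pinned (leaf∈C j l∉T) l∉S c∉C c∉T λ w _ e → inj₁ (leaf-neighbour j w e)
    -- Trading one leaf for the centre leaves the other leaf redundant.
    impossible (inj₁ l∉T) =
      minVCminus-irredundant
        (exchange-minVCminus minC (leaf∈C zero (l∉T zero)) c∉T
                             λ w _ e → inj₁ (leaf-neighbour zero w e))
        (∈-exchange⁺ {p = leaf zero} {q = centre} (leaf∈C (suc zero) (l∉T (suc zero))) λ ())
        λ w _ e → subst (_∈ exchange C (leaf zero) centre) (≡-sym (leaf-neighbour (suc zero) w e))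
                        (q∈exchange C (leaf zero) centre)

  Avoids : Subset (n spider) → Fin K → Set
  Avoids X i = inner i ∉ X × outer i ∉ X

  pinned-leg : ∀ {T S C} → PinnedMinVCminus T S C → LeavesFree T S → ∀ i → Avoids T i → ¬ Avoids S i
  pinned-leg {T} {S} {C} pinned@(minC@(cover , _) , _) free i (in∉T , out∉T) (in∉S , out∉S)
    with outer i ∈? C | inner i ∈? C
  ... | yes out∈C | yes in∈C =
    minVCminus-irredundant minC out∈C λ w _ e → subst (_∈ C) (≡-sym (outer-neighbour i w e)) in∈C
  ... | yes out∈C | no in∉C =
    pinned-noExchange pinned out∈C out∉S in∉C in∉T λ w _ e → inj₁ (outer-neighbour i w e)
  ... | no out∉C  | _ =
    pinned-noExchange pinned in∈C in∉S out∉C out∉T nbrs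
    where
    in∈C : inner i ∈ C
    in∈C = cover-forces cover out∉T in∉T (trans (adjacent-sym (outer i) (inner i)) (inner–outer i)) out∉C
    nbrs : NeighboursIn T (inner i) λ w → w ≡ outer i ⊎ w ∈ C
    nbrs w w∉T e with inner-neighbour i w e | pinned-centre pinned free
    ... | inj₂ refl | _         = inj₁ refl
    ... | inj₁ refl | inj₁ c∈T = ⊥-elim (w∉T c∈T)
    ... | inj₁ refl | inj₂ c∈C = inj₂ c∈C

  ¬avoids⇒meetsAllLegs : ∀ X → (∀ i → ¬ Avoids X i) → MeetsAllLegs X
  ¬avoids⇒meetsAllLegs X never i with inner i ∈? X | outer i ∈? X
  ... | yes in∈X | _         = inj₁ in∈X
  ... | no _     | yes out∈X = inj₂ out∈X
  ... | no in∉X  | no out∉X  = ⊥-elim (never i (in∉X , out∉X))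

  avoids⊥ : ∀ i → Avoids ⊥ i
  avoids⊥ i = ∉⊥ , ∉⊥

  pau-size : ∀ P → IsPAU spider P → K ≤ ∣ P ∣
  pau-size P pau with IsPAU⇒pinned pau
  ... | _ , pinned = meetsAllLegs⇒K≤∣P∣ P (¬avoids⇒meetsAllLegs P λ i →
                       pinned-leg pinned (inj₁ λ _ → ∉⊥) i (avoids⊥ i))

  mu-leafOutside⇒K≤∣T∣ : ∀ T j → IsMU spider T → leaf j ∉ T → K ≤ ∣ T ∣
  mu-leafOutside⇒K≤∣T∣ T j mu l∉T with IsMU⇒pinned mu
  ... | _ , pinned = meetsAllLegs⇒K≤∣P∣ T (¬avoids⇒meetsAllLegs T λ i avoids →
                       pinned-leg pinned (inj₂ (j , l∉T , ∉⊥)) i avoids (avoids⊥ i))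

  mu-size : 2 ≤ K → ∀ T → IsMU spider T → 2 ≤ ∣ T ∣
  mu-size 2≤K T mu with leaf zero ∈? T | leaf (suc zero) ∈? T
  ... | yes l₀∈T | yes l₁∈T = x≢y∈p⇒2≤∣p∣ l₀∈T l₁∈T λ ()
  ... | no l₀∉T  | _        = ≤-trans 2≤K (mu-leafOutside⇒K≤∣T∣ T zero mu l₀∉T)
  ... | yes _    | no l₁∉T  = ≤-trans 2≤K (mu-leafOutside⇒K≤∣T∣ T (suc zero) mu l₁∉T)

  leaves : Subset (n spider)
  leaves = outside ∷ inside ∷ inside ∷ ⊥

  ∣leaves∣≡2 : ∣ leaves ∣ ≡ 2
  ∣leaves∣≡2 = cong (λ m → 2 + m) (∣⊥∣≡0 (K * 2))

  leaf∈leaves : ∀ j → leaf j ∈ leaves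
  leaf∈leaves zero = there here
  leaf∈leaves (suc zero) = there (there here)

  leg∉leaves : ∀ {x} → suc (suc (suc x)) ∉ leaves
  leg∉leaves (there (there (there x∈⊥))) = ∉⊥ x∈⊥

  inners : Subset (n spider)
  inners = outside ∷ outside ∷ outside ∷ lefts K

  inner∈inners : ∀ i → inner i ∈ inners
  inner∈inners i = there (there (there (left∈lefts i)))

  ∈inners⇒inner : ∀ {x} → x ∈ inners → ∃ λ i → x ≡ inner i
  ∈inners⇒inner {x} x∈ with view x
  ... | innerᵛ i = i , refl
  ... | outerᵛ i = ⊥-elim (right∉lefts i (drop-there (drop-there (drop-there x∈))))
  ∈inners⇒inner () | centreᵛ
  ∈inners⇒inner (there ()) | leafᵛ zero
  ∈inners⇒inner (there (there ())) | leafᵛ (suc zero)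

  inners-cover : IsVCminus spider leaves inners
  inners-cover = avoids , covers
    where
    avoids : ∀ x → x ∈ inners → x ∉ leaves
    avoids x x∈ with ∈inners⇒inner x∈
    ... | i , refl = leg∉leaves
    covers : ∀ u v → u ∉ leaves → v ∉ leaves → adjacent u v ≡ true → u ∈ inners ⊎ v ∈ inners
    covers u v u∉ v∉ e with view u
    ... | leafᵛ j = ⊥-elim (u∉ (leaf∈leaves j))
    ... | innerᵛ i = inj₁ (inner∈inners i)
    ... | outerᵛ i = inj₂ (subst (_∈ inners) (≡-sym (outer-neighbour i v e)) (inner∈inners i))
    ... | centreᵛ with centre-neighbour v e
    ...   | inj₁ (j , refl) = ⊥-elim (v∉ (leaf∈leaves j))
    ...   | inj₂ (i , refl) = inj₂ (inner∈inners i)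

  cover-meetsAllLegs : ∀ {D} → IsVCminus spider leaves D → MeetsAllLegs D
  cover-meetsAllLegs (_ , covers) i = covers (inner i) (outer i) leg∉leaves leg∉leaves (inner–outer i)

  inners-minimum : IsMinVCminus spider leaves inners
  inners-minimum = inners-cover , λ D cover →
    subst (_≤ ∣ D ∣) (≡-sym (∣lefts∣≡K K)) (meetsAllLegs⇒K≤∣P∣ D (cover-meetsAllLegs cover))

  inners-unique : ∀ D → IsMinVCminus spider leaves D → D ≡ inners
  inners-unique D (cover , minimal) = ⊆-antisym D⊆inners inners⊆D
    where
    centre∉D : centre ∉ D
    centre∉D c∈D = <⇒≱ (meetsAllLegs⇒K<∣P∣ D c∈D (cover-meetsAllLegs cover))
                       (subst (∣ D ∣ ≤_) (∣lefts∣≡K K) (minimal inners inners-cover))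
    inner∈D : ∀ i → inner i ∈ D
    inner∈D i = cover-forces cover (λ ()) leg∉leaves (centre–inner i) centre∉D
    outer∉D : ∀ i → outer i ∉ D
    outer∉D i out∈D = minVCminus-irredundant (cover , minimal) out∈D
      λ w _ e → subst (_∈ D) (≡-sym (outer-neighbour i w e)) (inner∈D i)
    D⊆inners : D ⊆ inners
    D⊆inners {x} x∈D with view x
    ... | centreᵛ = ⊥-elim (centre∉D x∈D)
    ... | leafᵛ j = ⊥-elim (proj₁ cover _ x∈D (leaf∈leaves j))
    ... | innerᵛ i = inner∈inners i
    ... | outerᵛ i = ⊥-elim (outer∉D i x∈D)
    inners⊆D : inners ⊆ D
    inners⊆D x∈ with ∈inners⇒inner x∈
    ... | i , refl = inner∈D i

  leaves-MU : IsMU spider leaves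
  leaves-MU = inners , inners-minimum , inners-unique

theorem1 : (k : ℕ) → 3 ≤ k → Σ Graph λ G →
    (∀ P → IsMinPAU G P → k ≤ ∣ P ∣) × (∀ M → IsMinMU G M → ∣ M ∣ ≡ 2)
theorem1 k 3≤k = spider , (λ P → pau-size P ∘ proj₁) , λ M (mu , minimal) →
  ≤-antisym (subst (∣ M ∣ ≤_) ∣leaves∣≡2 (minimal leaves leaves-MU))
            (mu-size (≤-trans (n≤1+n 2) 3≤k) M mu)
  where open Spider k
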